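{- Let $X$ be a finite set of truth values, $\mathbf{2}=\{0,1\}$, let $\mathcal{L}_P$ be a many-valued predicate language, and let $\mathcal{M}_v$ be the Kripke model described in the context, with set of worlds $\mathcal{W}=X\cup\mathbf{2}$. Then for every assignment $g$ and every ground formula $\Phi/g$ of the positive multi-modal language $\mathcal{L}_M$, we have $\|\Phi/g\|\in\{\emptyset,\mathcal{W}\}$.
   Context: $\mathcal{L}_P$ is built from: - a set $P$ of predicate symbols with arities; - a set $F$ of function symbols; - a set $S$ of constants (individuals); - variables $Var$; - connectives in a set $\Sigma$ interpreted as functions $X^n\to X$. Terms and atoms are defined as usual; $H$ is the set of ground atoms, and $\mathcal{L}$ is the set of ground formulae of $\mathcal{L}_P$. For an assignment $g:Var\to S$, $\phi/g$ denotes the ground formula obtained by applying $g$. $\mathcal{L}_M^*$ is the smallest set such that: $0,1\in\mathcal{L}_M^*$; $[x]\phi\in\mathcal{L}_M^*$ for $x\in X$ and $\phi\in\mathcal{L}_P$; $[x]\Phi\in\mathcal{L}_M^*$ for $x\in\mathbf{2}$ and $\Phi\in\mathcal{L}_M^*$; and $\mathcal{L}_M^*$ is closed under $\wedge$ and $\vee$. $\mathcal{L}_M$ is its ground (variable-free) part. The Kripke model $\mathcal{M}_v=(\mathcal{W},\{\mathcal{R}_w\}_{w\in\mathcal{W}},S,V)$ is defined as follows: - $\mathcal{W}=X\cup\mathbf{2}$; - $\mathcal{R}_w=\mathcal{W}\times\{w\}$; - $V$ assigns to each world $w$ and each $n$-ary $p\in P$ a map $V(w,p):S^n\to\mathbf{2}$,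 such that for each tuple $(c_1,\dots,c_n)\in S^n$ there is a unique $w$ with $V(w,p)(c_1,\dots,c_n)=1$. This defines the valuation $v(p(c_1,\dots,c_n))=w$ iff $V(w,p)(c_1,\dots,c_n)=1$, extended homomorphically to all of $\mathcal{L}$. Satisfaction is defined by: - $\mathcal{M}_v\models_{g,w}\phi$ iff $v(\phi/g)=w$, for $\phi\in\mathcal{L}_P$; - $1$ holds at every world and $0$ at none; - $\mathcal{M}_v\models_{g,w}[x]\Phi$ iff for all $y$ with $(w,y)\in\mathcal{R}_x$, $\mathcal{M}_v\models_{g,y}\Phi$; - $\wedge$ and $\vee$ are interpreted classically. $\|\Phi/g\|$ is the set of worlds $w$ with $\mathcal{M}_v\models_{g,w}\Phi$. -}

module Defs where

open import Data.Nat using (ℕ)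
open import Data.Fin using (Fin)
open import Data.Bool using (Bool)
open import Data.Vec using (Vec; []; _∷_)
open import Data.Sum using (_⊎_; inj₁; inj₂)
open import Data.Product using (_×_)
open import Data.Empty using (⊥)
open import Data.Unit using (⊤)
open import Relation.Unary using (Pred; Empty; Universal)
open import Relation.Binary.PropositionalEquality using (_≡_)
open import Level using (0ℓ)

record Lang : Set₁ where
  field
    P    : Set
    arP  : P → ℕ
    F    : Set
    arF  : F → ℕ
    S    : Set
    Var  : Set
    Conn : Set
    arC  : Conn → ℕ
open Lang public

module _ (L : Lang) where

  data Term : Set where
    var  : Var L → Term
    cst  : S L → Term
    fun  : (f : F L) → Vec Term (arF L f) → Term

  data Form : Set where
    atom : (p : P L) → Vec Term (arP L p) → Form
    conn : (c : Conn L) → Vec Form (arC L c) → Form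

  -- ground terms and ground formulae (H ⊆ GForm are the ground atoms, GForm = 𝓛)
  data GTerm : Set where
    gcst : S L → GTerm
    gfun : (f : F L) → Vec GTerm (arF L f) → GTerm

  data GForm : Set where
    gatom : (p : P L) → Vec GTerm (arP L p) → GForm
    gconn : (c : Conn L) → Vec GForm (arC L c) → GForm

  Assignment : Set
  Assignment = Var L → S L

  mutual
    substT : Assignment → Term → GTerm
    substT g (var x)    = gcst (g x)
    substT g (cst c)    = gcst c
    substT g (fun f ts) = gfun f (substTs g ts)

    substTs : ∀ {n} → Assignment → Vec Term n → Vec GTerm n
    substTs g []       = []
    substTs g (t ∷ ts) = substT g t ∷ substTs g ts

  mutual
    substF : Assignment → Form → GForm
    substF g (atom p ts) = gatom p (substTs g ts)
    substF g (conn c φs) = gconn c (substFs g φs)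

    substFs : ∀ {n} → Assignment → Vec Form n → Vec GForm n
    substFs g []       = []
    substFs g (φ ∷ φs) = substF g φ ∷ substFs g φs

  module _ (n : ℕ) where
    X : Set
    X = Fin n

    Interp : Set
    Interp = (c : Conn L) → Vec X (arC L c) → X

    -- the value of each ground atom: v(p(c₁,…,cₖ)) = the unique world w with
    -- V(w,p)(c₁,…,cₖ) = 1
    AtomVal : Set
    AtomVal = (p : P L) → Vec GTerm (arP L p) → X

    mutual
      val : Interp → AtomVal → GForm → X
      val I V (gatom p ts) = V p ts
      val I V (gconn c φs) = I c (vals I V φs)

      vals : ∀ {k} → Interp → AtomVal → Vec GForm k → Vec X k
      vals I V []       = []
      vals I V (φ ∷ φs) = val I V φ ∷ vals I V φs

    World : Set
    World = X ⊎ Bool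

    R : World → World → World → Set
    R w u y = y ≡ w

    data LM : Set where
      𝟘 𝟙   : LM
      boxX  : X → Form → LM
      box2  : Bool → LM → LM
      _∧M_ : LM → LM → LM
      _∨M_ : LM → LM → LM

    satP : Interp → AtomVal → Assignment → World → Form → Set
    satP I V g w φ = w ≡ inj₁ (val I V (substF g φ))

    sat : Interp → AtomVal → Assignment → World → LM → Set
    sat I V g w 𝟘          = ⊥
    sat I V g w 𝟙          = ⊤
    sat I V g w (boxX x φ) = ∀ y → R (inj₁ x) w y → satP I V g y φ
    sat I V g w (box2 b Φ) = ∀ y → R (inj₂ b) w y → sat I V g y Φ
    sat I V g w (Φ ∧M Ψ)  = sat I V g w Φ × sat I V g w Ψ
    sat I V g w (Φ ∨M Ψ)  = sat I V g w Φ ⊎ sat I V g w Ψ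

    ext : Interp → AtomVal → Assignment → LM → Pred World 0ℓ
    ext I V g Φ w = sat I V g w Φ

module Submission where

-- Every accessibility relation 𝓡_x points only at x, so [x]Φ holds at one world
-- iff Φ holds at x, independently of the world: boxed formulas (and 0, 1) have
-- truth set ∅ or 𝒲, and sets of that kind are closed under ∩ and ∪.

open import Defs
open import Data.Nat using (ℕ)
open import Data.Sum using (_⊎_; inj₁; inj₂; [_,_])
open import Data.Product using (_,_; proj₁; proj₂)
open import Data.Unit using (tt)
open import Data.Sum.Properties using (inj₁-injective)
open import Data.Fin.Properties using () renaming (_≟_ to _≟ᶠ_)
open import Relation.Unary using (Pred; Empty; Universal; _∩_; _∪_)
open import Relation.Nullary using (yes; no)
open import Relation.Binary.PropositionalEquality using (refl)

Trivial : ∀ {a ℓ} {A : Set a} → Pred A ℓ → Set _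
Trivial P = Empty P ⊎ Universal P

module _ {a ℓ} {A : Set a} {P Q : Pred A ℓ} where

  ∩-trivial : Trivial P → Trivial Q → Trivial (P ∩ Q)
  ∩-trivial (inj₁ ∅P) _          = inj₁ λ x PQx → ∅P x (proj₁ PQx)
  ∩-trivial _          (inj₁ ∅Q) = inj₁ λ x PQx → ∅Q x (proj₂ PQx)
  ∩-trivial (inj₂ ∀P) (inj₂ ∀Q)  = inj₂ λ x → ∀P x , ∀Q x

  ∪-trivial : Trivial P → Trivial Q → Trivial (P ∪ Q)
  ∪-trivial (inj₂ ∀P) _          = inj₂ λ x → inj₁ (∀P x)
  ∪-trivial _          (inj₂ ∀Q) = inj₂ λ x → inj₂ (∀Q x)
  ∪-trivial (inj₁ ∅P) (inj₁ ∅Q)  = inj₁ λ x → [ ∅P x , ∅Q x ]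

module _ (L : Lang) (n : ℕ) (I : Interp L n) (V : AtomVal L n) (g : Assignment L) where

  private
    ‖_‖ : LM L n → Pred (World L n) _
    ‖ Φ ‖ = ext L n I V g Φ

  boxX-trivial : ∀ x φ → Trivial ‖ boxX x φ ‖
  boxX-trivial x φ with x ≟ᶠ val L n I V (substF L g φ)
  ... | yes refl = inj₂ λ { w _ refl → refl }
  ... | no x≢v   = inj₁ λ w □φ → x≢v (inj₁-injective (□φ (inj₁ x) refl))

  box2-trivial : ∀ b Φ → Trivial ‖ Φ ‖ → Trivial ‖ box2 b Φ ‖
  box2-trivial b Φ (inj₁ ∅Φ) = inj₁ λ w □Φ → ∅Φ (inj₂ b) (□Φ (inj₂ b) refl)
  box2-trivial b Φ (inj₂ ∀Φ) = inj₂ λ w y _ → ∀Φ y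

  ext-trivial : ∀ Φ → Trivial ‖ Φ ‖
  ext-trivial 𝟘          = inj₁ λ _ ()
  ext-trivial 𝟙          = inj₂ λ _ → tt
  ext-trivial (boxX x φ) = boxX-trivial x φ
  ext-trivial (box2 b Φ) = box2-trivial b Φ (ext-trivial Φ)
  ext-trivial (Φ ∧M Ψ)   = ∩-trivial (ext-trivial Φ) (ext-trivial Ψ)
  ext-trivial (Φ ∨M Ψ)   = ∪-trivial (ext-trivial Φ) (ext-trivial Ψ)

mainTheorem7 : (L : Lang) (n : ℕ) (I : Interp L n) (V : AtomVal L n)
               (g : Assignment L) (Φ : LM L n) →
               Empty (ext L n I V g Φ) ⊎ Universal (ext L n I V g Φ)
mainTheorem7 = ext-trivial
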